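{- Let $p\ge 2$ be an integer. Then $$\Gamma(K_{p+1,p+1}\,\square\, K_{p+1,p+1}) \ge \Gamma(K_{p,p}\,\square\, K_{p,p})+1.$$ Consequently, $\Gamma(K_{p,p}\,\square\, K_{p,p})\ge p+1$ for every $p\ge 2$.
   Context: $K_{p,p}$ is the complete bipartite graph with $p$ vertices in each part. The Cartesian product $G\,\square\, H$ has vertex set $V(G)\times V(H)$, and $(a,x)(b,y)$ is an edge iff either $a=b$ and $xy\in E(H)$, or $ab\in E(G)$ and $x=y$. A greedy $k$-colouring of a graph is a partition of its vertex set into $k$ nonempty stable sets $S_1,\dots,S_k$ such that for every $j<i$, every vertex of $S_i$ has a neighbour in $S_j$. The Grundy number $\Gamma$ is the largest such $k$. -}

module Defs where

open import Level using (0ℓ)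
open import Data.Nat using (ℕ; _+_; _≤_)
open import Data.Fin using (Fin; _<_)
open import Data.Bool using (Bool)
open import Data.Product using (_×_; ∃; ∃-syntax; _,_)
open import Relation.Binary.PropositionalEquality using (_≡_; _≢_)

record Graph : Set₁ where
  field
    V : Set
    Adj : V → V → Set
open Graph public

K : ℕ → Graph
K p = record { V = Bool × Fin p ; Adj = λ { (s , _) (t , _) → s ≢ t } }

_□_ : Graph → Graph → Graph
G □ H = record
  { V = V G × V H
  ; Adj = λ { (a , x) (b , y) → (a ≡ b × Adj H x y) Data.Sum.⊎ (Adj G a b × x ≡ y) }
  }
  where import Data.Sum

record GreedyColouring (G : Graph) (k : ℕ) : Set where
  field
    colour   : V G → Fin k
    nonempty : ∀ (i : Fin k) → ∃[ v ] colour v ≡ i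
    stable   : ∀ u v → Adj G u v → colour u ≢ colour v
    greedy   : ∀ v (j : Fin k) → j < colour v → ∃[ u ] (Adj G v u × colour u ≡ j)

IsGrundyNumber : Graph → ℕ → Set
IsGrundyNumber G g = GreedyColouring G g × (∀ k → GreedyColouring G k → k ≤ g)

-- Take a greedy colouring of K_{p,p} □ K_{p,p} and shift all its colours up by one.  Add a
-- new vertex 0 to both sides of each factor and colour the new vertices of
-- K_{p+1,p+1} □ K_{p+1,p+1} as follows: ((a,i),(a,0)) and ((a,0),(¬a,j)) with i, j old get 0,
-- ((a,0),(a,0)) gets 1 and ((a,0),(¬a,0)) gets 2.  The remaining new vertices ((a,i),(¬a,0))
-- and ((a,0),(a,j)) form a stable set, so each of them can take the least colour missing
-- from its (already coloured) neighbourhood.  An old vertex recoloured c + 1 still sees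
-- 1,…,c in the old copy and 0 at a new vertex, so the result is greedy with one colour
-- more.  Starting from the 2-colouring of K_{1,1} □ K_{1,1} by "same side / opposite sides"
-- gives Γ ≥ p + 1.

module Submission where

open import Defs
open import Data.Bool using (Bool; true; false; not)
open import Data.Bool.Properties using (not-¬)
open import Data.Empty using (⊥-elim)
open import Data.Fin using (Fin; zero; suc; toℕ; fromℕ; fromℕ<)
open import Data.Fin.Properties using (toℕ-injective; toℕ-fromℕ<; toℕ-fromℕ; toℕ-inject; toℕ<n; ¬Fin0; ¬∀⟶∃¬-smallest)
open import Data.List using (List; _∷_; []; map; allFin; cartesianProduct)
open import Data.List.Extrema.Nat using (max; argmax; xs≤max; f[xs]≤f[argmax])
open import Data.List.Membership.Propositional using (_∈_; _∉_)
open import Data.List.Membership.Propositional.Properties using (∈-cartesianProduct⁺; ∈-allFin; ∈-map⁺; ∈-map⁻)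
open import Data.List.Relation.Unary.All using (lookup)
open import Data.List.Relation.Unary.Any using (here; there)
open import Data.Nat using (ℕ; zero; suc; _+_; _≤_; _<_; s≤s; ≤-pred)
open import Data.Nat.Properties using (≤∧≢⇒<; <-trans; ≤-<-trans; ≤-trans; _≟_; 1+n≰n; suc-injective; +-comm)
open import Data.List.Membership.DecPropositional _≟_ using (_∈?_)
open import Data.Product using (_×_; _,_; ∃-syntax; proj₁; proj₂)
open import Data.Sum using (inj₁; inj₂)
open import Function using (_∘_)
open import Relation.Binary.PropositionalEquality using (_≡_; _≢_; refl; sym; trans; cong; subst; ≢-sym)
open import Relation.Nullary using (¬_; yes; no)
open import Relation.Unary using (Pred; Decidable)

record GreedyLabelling (G : Graph) : Set where
  field
    label    : V G → ℕ
    proper   : ∀ u v → Adj G u v → label u ≢ label v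
    complete : ∀ v j → j < label v → ∃[ u ] (Adj G v u × label u ≡ j)
open GreedyLabelling

module _ {G : Graph} where

  colouring⇒labelling : ∀ {k} → GreedyColouring G k → GreedyLabelling G
  colouring⇒labelling g = record
    { label    = toℕ ∘ colour
    ; proper   = λ u v uv → stable u v uv ∘ toℕ-injective
    ; complete = λ v j j<c →
        let j<k           = <-trans j<c (toℕ<n (colour v))
            u , vu , cu≡j = greedy v (fromℕ< j<k) (subst (_< toℕ (colour v)) (sym (toℕ-fromℕ< j<k)) j<c)
        in  u , vu , trans (cong toℕ cu≡j) (toℕ-fromℕ< j<k)
    }
    where open GreedyColouring g

  module _ (ℓ : GreedyLabelling G) where

    boundedLabelling⇒colouring : ∀ {m} → (∀ v → label ℓ v ≤ m) → ∃[ w ] label ℓ w ≡ m →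
                                 GreedyColouring G (suc m)
    boundedLabelling⇒colouring {m} bound (w , ℓw≡m) = record
      { colour   = colour
      ; nonempty = attained
      ; stable   = λ u v uv cu≡cv →
          proper ℓ u v uv (trans (sym (toℕ-colour u)) (trans (cong toℕ cu≡cv) (toℕ-colour v)))
      ; greedy   = λ v j j<cv →
          let u , vu , ℓu≡j = complete ℓ v (toℕ j) (subst (toℕ j <_) (toℕ-colour v) j<cv)
          in  u , vu , colour≡ ℓu≡j
      }
      where
      colour : V G → Fin (suc m)
      colour v = fromℕ< (s≤s (bound v))

      toℕ-colour : ∀ v → toℕ (colour v) ≡ label ℓ v
      toℕ-colour v = toℕ-fromℕ< (s≤s (bound v))

      colour≡ : ∀ {u} {i : Fin (suc m)} → label ℓ u ≡ toℕ i → colour u ≡ i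
      colour≡ {u} ℓu≡i = toℕ-injective (trans (toℕ-colour u) ℓu≡i)

      attained : ∀ i → ∃[ u ] colour u ≡ i
      attained i with toℕ i ≟ m
      ... | yes i≡m = w , colour≡ (trans ℓw≡m (sym i≡m))
      ... | no  i≢m =
        let i<m = ≤∧≢⇒< (≤-pred (toℕ<n i)) i≢m
            u , _ , ℓu≡i = complete ℓ w (toℕ i) (subst (toℕ i <_) (sym ℓw≡m) i<m)
        in  u , colour≡ ℓu≡i

    finiteLabelling⇒colouring : (vs : List (V G)) → (∀ v → v ∈ vs) → V G →
                                ∃[ k ] GreedyColouring G k × (∀ v → label ℓ v < k)
    finiteLabelling⇒colouring vs ∈vs v₀ =
      suc (label ℓ w) , boundedLabelling⇒colouring bound (w , refl) , s≤s ∘ bound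
      where
      w : V G
      w = argmax (label ℓ) v₀ vs

      bound : ∀ v → label ℓ v ≤ label ℓ w
      bound v = lookup (f[xs]≤f[argmax] v₀ vs) (∈vs v)

leastMissing : ∀ {p} {P : Pred ℕ p} → Decidable P → ∀ n → ¬ P n →
               ∃[ m ] ¬ P m × (∀ {j} → j < m → P j)
leastMissing {P = P} P? n ¬Pn
  with i , ¬Pi , P-below-i ← ¬∀⟶∃¬-smallest (suc n) (P ∘ toℕ) (P? ∘ toℕ)
                               (λ ∀P → ¬Pn (subst P (toℕ-fromℕ n) (∀P (fromℕ n))))
  = toℕ i , ¬Pi , λ j<i → subst P (trans (toℕ-inject _) (toℕ-fromℕ< j<i)) (P-below-i (fromℕ< j<i))

-- Opaque so that unification never unfolds the search behind mex.
opaque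
  mexSpec : ∀ xs → ∃[ m ] m ∉ xs × (∀ {j} → j < m → j ∈ xs)
  mexSpec xs = leastMissing (_∈? xs) (suc (max 0 xs)) (λ ∈xs → 1+n≰n (lookup (xs≤max 0 xs) ∈xs))

  mex : List ℕ → ℕ
  mex xs = proj₁ (mexSpec xs)

  ∈⇒≢mex : ∀ {x xs} → x ∈ xs → x ≢ mex xs
  ∈⇒≢mex {xs = xs} x∈xs x≡mex = proj₁ (proj₂ (mexSpec xs)) (subst (_∈ xs) x≡mex x∈xs)

  <mex⇒∈ : ∀ {j} xs → j < mex xs → j ∈ xs
  <mex⇒∈ xs = proj₂ (proj₂ (mexSpec xs))

K□K : ℕ → Graph
K□K p = K p □ K p

sides : List Bool
sides = true ∷ false ∷ []

∈-sides : ∀ s → s ∈ sides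
∈-sides true  = here refl
∈-sides false = there (here refl)

sideVertices : ∀ p → List (V (K p))
sideVertices p = cartesianProduct sides (allFin p)

∈-sideVertices : ∀ {p} v → v ∈ sideVertices p
∈-sideVertices (s , x) = ∈-cartesianProduct⁺ (∈-sides s) (∈-allFin x)

vertices : ∀ p → List (V (K□K p))
vertices p = cartesianProduct (sideVertices p) (sideVertices p)

∈-vertices : ∀ {p} v → v ∈ vertices p
∈-vertices (x , y) = ∈-cartesianProduct⁺ (∈-sideVertices x) (∈-sideVertices y)

proper-by-sides : ∀ {p} (c : V (K□K p) → ℕ) →
                  (∀ a x y y′ → c ((a , x) , (false , y)) ≢ c ((a , x) , (true , y′))) →
                  (∀ x x′ b y → c ((false , x) , (b , y)) ≢ c ((true , x′) , (b , y))) →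
                  ∀ u v → Adj (K□K p) u v → c u ≢ c v
proper-by-sides c row col ((a , x) , (false , y)) (_ , (true , y′)) (inj₁ (refl , _)) = row a x y y′
proper-by-sides c row col ((a , x) , (true , y)) (_ , (false , y′)) (inj₁ (refl , _)) = ≢-sym (row a x y′ y)
proper-by-sides c row col (_ , (false , _)) (_ , (false , _)) (inj₁ (_ , f≢f)) = ⊥-elim (f≢f refl)
proper-by-sides c row col (_ , (true , _))  (_ , (true , _))  (inj₁ (_ , t≢t)) = ⊥-elim (t≢t refl)
proper-by-sides c row col ((false , x) , (b , y)) ((true , x′) , _) (inj₂ (_ , refl)) = col x x′ b y
proper-by-sides c row col ((true , x) , (b , y)) ((false , x′) , _) (inj₂ (_ , refl)) = ≢-sym (col x′ x b y)
proper-by-sides c row col ((false , _) , _) ((false , _) , _) (inj₂ (f≢f , _)) = ⊥-elim (f≢f refl)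
proper-by-sides c row col ((true , _) , _)  ((true , _) , _)  (inj₂ (t≢t , _)) = ⊥-elim (t≢t refl)

sideLabelling : ∀ p → GreedyLabelling (K□K p)
sideLabelling p = record
  { label    = sideLabel
  ; proper   = proper-by-sides sideLabel (λ { false _ _ _ () ; true _ _ _ () })
                                         (λ { _ _ false _ () ; _ _ true _ () })
  ; complete = complete′
  }
  where
  sideLabel : V (K□K p) → ℕ
  sideLabel ((false , _) , (false , _)) = 0
  sideLabel ((true  , _) , (true  , _)) = 0
  sideLabel ((false , _) , (true  , _)) = 1
  sideLabel ((true  , _) , (false , _)) = 1

  complete′ : ∀ v j → j < sideLabel v → ∃[ u ] (Adj (K□K p) v u × sideLabel u ≡ j)
  complete′ ((false , x) , (true  , y)) zero _ = ((false , x) , (false , y)) , inj₁ (refl , λ ()) , refl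
  complete′ ((true  , x) , (false , y)) zero _ = ((true  , x) , (true  , y)) , inj₁ (refl , λ ()) , refl
  complete′ ((false , _) , (true  , _)) (suc _) (s≤s ())
  complete′ ((true  , _) , (false , _)) (suc _) (s≤s ())
  complete′ ((false , _) , (false , _)) _ ()
  complete′ ((true  , _) , (true  , _)) _ ()

module Extension {n : ℕ} (ℓ : GreedyLabelling (K□K (suc n))) where

  shift : V (K (suc n)) → V (K (suc (suc n)))
  shift (s , i) = s , suc i

  lift : V (K□K (suc n)) → V (K□K (suc (suc n)))
  lift (x , y) = shift x , shift y

  lift-adj : ∀ {u v} → Adj (K□K (suc n)) u v → Adj (K□K (suc (suc n))) (lift u) (lift v)
  lift-adj (inj₁ (x≡x′ , y~y′)) = inj₁ (cong shift x≡x′ , y~y′)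
  lift-adj (inj₂ (x~x′ , y≡y′)) = inj₂ (x~x′ , cong shift y≡y′)

  -- The labels of the neighbours of ((a , suc i) , (not a , zero)), resp. ((b , zero) , (b , suc j)).
  rowColours : Bool → Fin (suc n) → List ℕ
  rowColours a i = 0 ∷ 1 ∷ map (λ j → suc (label ℓ ((a , i) , (a , j)))) (allFin (suc n))

  colColours : Bool → Fin (suc n) → List ℕ
  colColours b j = 0 ∷ 2 ∷ map (λ i → suc (label ℓ ((not b , i) , (b , j)))) (allFin (suc n))

  old∈rowColours : ∀ a i j → suc (label ℓ ((a , i) , (a , j))) ∈ rowColours a i
  old∈rowColours a i j = there (there (∈-map⁺ _ (∈-allFin j)))

  old∈colColours : ∀ b j i → suc (label ℓ ((not b , i) , (b , j))) ∈ colColours b j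
  old∈colColours b j i = there (there (∈-map⁺ _ (∈-allFin i)))

  label′ : V (K□K (suc (suc n))) → ℕ
  label′ ((a , suc i) , (b , suc j)) = suc (label ℓ ((a , i) , (b , j)))
  label′ ((false , zero) , (false , zero)) = 1
  label′ ((true  , zero) , (true  , zero)) = 1
  label′ ((false , zero) , (true  , zero)) = 2
  label′ ((true  , zero) , (false , zero)) = 2
  label′ ((false , suc _) , (false , zero)) = 0
  label′ ((true  , suc _) , (true  , zero)) = 0
  label′ ((false , zero) , (true  , suc _)) = 0
  label′ ((true  , zero) , (false , suc _)) = 0
  label′ ((false , suc i) , (true  , zero)) = mex (rowColours false i)
  label′ ((true  , suc i) , (false , zero)) = mex (rowColours true i)
  label′ ((false , zero) , (false , suc j)) = mex (colColours false j)
  label′ ((true  , zero) , (true  , suc j)) = mex (colColours true j)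

  old-proper : ∀ {u v} → Adj (K□K (suc n)) u v → label′ (lift u) ≢ label′ (lift v)
  old-proper {u} {v} uv = proper ℓ u v uv ∘ suc-injective

  row-proper : ∀ a x y y′ → label′ ((a , x) , (false , y)) ≢ label′ ((a , x) , (true , y′))
  row-proper a     (suc i) (suc j) (suc j′) = old-proper (inj₁ (refl , λ ()))
  row-proper false zero    zero    zero     = λ ()
  row-proper false zero    zero    (suc _)  = λ ()
  row-proper false zero    (suc j) zero     = ≢-sym (∈⇒≢mex (there (here refl)))
  row-proper false zero    (suc j) (suc _)  = ≢-sym (∈⇒≢mex (here refl))
  row-proper false (suc i) zero    zero     = ∈⇒≢mex (here refl)
  row-proper false (suc i) zero    (suc _)  = λ ()
  row-proper false (suc i) (suc j) zero     = ∈⇒≢mex (old∈rowColours false i j)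
  row-proper true  zero    zero    zero     = λ ()
  row-proper true  zero    zero    (suc _)  = ∈⇒≢mex (there (here refl))
  row-proper true  zero    (suc _) zero     = λ ()
  row-proper true  zero    (suc _) (suc _)  = ∈⇒≢mex (here refl)
  row-proper true  (suc i) zero    zero     = ≢-sym (∈⇒≢mex (here refl))
  row-proper true  (suc i) zero    (suc j′) = ≢-sym (∈⇒≢mex (old∈rowColours true i j′))
  row-proper true  (suc i) (suc j) zero     = λ ()

  col-proper : ∀ x x′ b y → label′ ((false , x) , (b , y)) ≢ label′ ((true , x′) , (b , y))
  col-proper (suc i) (suc i′) b     (suc j) = old-proper (inj₂ ((λ ()) , refl))
  col-proper zero    zero     false zero    = λ ()
  col-proper zero    zero     false (suc j) = ≢-sym (∈⇒≢mex (here refl))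
  col-proper zero    (suc i′) false zero    = ∈⇒≢mex (there (here refl))
  col-proper zero    (suc i′) false (suc j) = ≢-sym (∈⇒≢mex (old∈colColours false j i′))
  col-proper (suc i) zero     false zero    = λ ()
  col-proper (suc i) zero     false (suc j) = λ ()
  col-proper (suc i) (suc i′) false zero    = ∈⇒≢mex (here refl)
  col-proper zero    zero     true  zero    = λ ()
  col-proper zero    zero     true  (suc j) = ∈⇒≢mex (here refl)
  col-proper zero    (suc i′) true  zero    = λ ()
  col-proper zero    (suc i′) true  (suc j) = λ ()
  col-proper (suc i) zero     true  zero    = ≢-sym (∈⇒≢mex (there (here refl)))
  col-proper (suc i) zero     true  (suc j) = ∈⇒≢mex (old∈colColours true j i)
  col-proper (suc i) (suc i′) true  zero    = ≢-sym (∈⇒≢mex (here refl))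

  Witness : V (K□K (suc (suc n))) → ℕ → Set
  Witness v m = ∃[ u ] (Adj (K□K (suc (suc n))) v u × label′ u ≡ m)

  row-witness : ∀ a i {m} → m ∈ rowColours a i → Witness ((a , suc i) , (not a , zero)) m
  row-witness false i (here refl) = ((false , suc i) , (false , zero)) , inj₁ (refl , λ ()) , refl
  row-witness true  i (here refl) = ((true , suc i) , (true , zero)) , inj₁ (refl , λ ()) , refl
  row-witness false i (there (here refl)) = ((true , zero) , (true , zero)) , inj₂ ((λ ()) , refl) , refl
  row-witness true  i (there (here refl)) = ((false , zero) , (false , zero)) , inj₂ ((λ ()) , refl) , refl
  row-witness a     i (there (there old)) with j , _ , refl ← ∈-map⁻ _ old =
    ((a , suc i) , (a , suc j)) , inj₁ (refl , ≢-sym (not-¬ refl)) , refl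

  col-witness : ∀ b j {m} → m ∈ colColours b j → Witness ((b , zero) , (b , suc j)) m
  col-witness false j (here refl) = ((true , zero) , (false , suc j)) , inj₂ ((λ ()) , refl) , refl
  col-witness true  j (here refl) = ((false , zero) , (true , suc j)) , inj₂ ((λ ()) , refl) , refl
  col-witness false j (there (here refl)) = ((false , zero) , (true , zero)) , inj₁ (refl , λ ()) , refl
  col-witness true  j (there (here refl)) = ((true , zero) , (false , zero)) , inj₁ (refl , λ ()) , refl
  col-witness b     j (there (there old)) with i , _ , refl ← ∈-map⁻ _ old =
    ((not b , suc i) , (b , suc j)) , inj₂ (not-¬ refl , refl) , refl

  complete′ : ∀ v m → m < label′ v → Witness v m
  complete′ ((a , suc i) , (b , suc j)) (suc m) (s≤s m<ℓ) =
    let u , vu , ℓu≡m = complete ℓ ((a , i) , (b , j)) m m<ℓ in lift u , lift-adj vu , cong suc ℓu≡m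
  complete′ ((false , suc i) , (false , suc j)) zero _ = ((true , zero) , (false , suc j)) , inj₂ ((λ ()) , refl) , refl
  complete′ ((true  , suc i) , (true  , suc j)) zero _ = ((false , zero) , (true , suc j)) , inj₂ ((λ ()) , refl) , refl
  complete′ ((false , suc i) , (true  , suc j)) zero _ = ((false , suc i) , (false , zero)) , inj₁ (refl , λ ()) , refl
  complete′ ((true  , suc i) , (false , suc j)) zero _ = ((true , suc i) , (true , zero)) , inj₁ (refl , λ ()) , refl
  complete′ ((false , zero) , (false , zero)) zero _ = ((false , zero) , (true , suc zero)) , inj₁ (refl , λ ()) , refl
  complete′ ((true  , zero) , (true  , zero)) zero _ = ((true , zero) , (false , suc zero)) , inj₁ (refl , λ ()) , refl
  complete′ ((false , zero) , (true  , zero)) zero _ = ((true , suc zero) , (true , zero)) , inj₂ ((λ ()) , refl) , refl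
  complete′ ((true  , zero) , (false , zero)) zero _ = ((false , suc zero) , (false , zero)) , inj₂ ((λ ()) , refl) , refl
  complete′ ((false , zero) , (true  , zero)) 1 _ = ((false , zero) , (false , zero)) , inj₁ (refl , λ ()) , refl
  complete′ ((true  , zero) , (false , zero)) 1 _ = ((false , zero) , (false , zero)) , inj₂ ((λ ()) , refl) , refl
  complete′ ((false , zero) , (false , zero)) (suc _) (s≤s ())
  complete′ ((true  , zero) , (true  , zero)) (suc _) (s≤s ())
  complete′ ((false , zero) , (true  , zero)) (suc (suc _)) (s≤s (s≤s ()))
  complete′ ((true  , zero) , (false , zero)) (suc (suc _)) (s≤s (s≤s ()))
  complete′ ((false , suc _) , (false , zero)) _ ()
  complete′ ((true  , suc _) , (true  , zero)) _ ()
  complete′ ((false , zero) , (true  , suc _)) _ ()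
  complete′ ((true  , zero) , (false , suc _)) _ ()
  complete′ ((false , suc i) , (true  , zero)) _ m<ℓ = row-witness false i (<mex⇒∈ (rowColours false i) m<ℓ)
  complete′ ((true  , suc i) , (false , zero)) _ m<ℓ = row-witness true  i (<mex⇒∈ (rowColours true i) m<ℓ)
  complete′ ((false , zero) , (false , suc j)) _ m<ℓ = col-witness false j (<mex⇒∈ (colColours false j) m<ℓ)
  complete′ ((true  , zero) , (true  , suc j)) _ m<ℓ = col-witness true  j (<mex⇒∈ (colColours true j) m<ℓ)

  extension : GreedyLabelling (K□K (suc (suc n)))
  extension = record
    { label    = label′
    ; proper   = proper-by-sides label′ row-proper col-proper
    ; complete = complete′
    }

greedyColouring-grows : ∀ {n a} → GreedyColouring (K□K (suc n)) a →
                        ∃[ b ] GreedyColouring (K□K (suc (suc n))) b × a < b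
greedyColouring-grows {n} {zero} g = ⊥-elim (¬Fin0 (colour ((true , zero) , (true , zero))))
  where open GreedyColouring g
greedyColouring-grows {n} {suc a} g =
  let w , cw≡a = nonempty (fromℕ a)
      b , g′ , bound = finiteLabelling⇒colouring extension (vertices _) ∈-vertices (lift w)
  in  b , g′ , subst (λ c → suc c < b) (trans (cong toℕ cw≡a) (toℕ-fromℕ a)) (bound (lift w))
  where
  open GreedyColouring g
  open Extension (colouring⇒labelling g) using (extension; lift)

large-greedyColouring : ∀ n → ∃[ k ] GreedyColouring (K□K (suc n)) k × suc n < k
large-greedyColouring zero =
  let k , g , bound = finiteLabelling⇒colouring (sideLabelling 1) (vertices 1) ∈-vertices v
  in  k , g , bound v
  where v = (false , zero) , (true , zero)
large-greedyColouring (suc n) =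
  let k  , g  , n<k  = large-greedyColouring n
      k′ , g′ , k<k′ = greedyColouring-grows g
  in  k′ , g′ , ≤-<-trans n<k k<k′

proposition22 : ∀ (p : ℕ) → 2 ≤ p →
    (∀ (a b : ℕ) → IsGrundyNumber (K p □ K p) a →
                   IsGrundyNumber (K (suc p) □ K (suc p)) b → a + 1 ≤ b)
    × (∀ (g : ℕ) → IsGrundyNumber (K p □ K p) g → p + 1 ≤ g)
-- The construction already works for p = 1.
proposition22 (suc p) _ = grows , lowerBound
  where
  grows : ∀ a b → IsGrundyNumber (K□K (suc p)) a → IsGrundyNumber (K□K (suc (suc p))) b → a + 1 ≤ b
  grows a b (colouring-a , _) (_ , maximal-b) =
    let k , colouring-k , a<k = greedyColouring-grows colouring-a
    in  subst (_≤ b) (+-comm 1 a) (≤-trans a<k (maximal-b k colouring-k))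

  lowerBound : ∀ g → IsGrundyNumber (K□K (suc p)) g → suc p + 1 ≤ g
  lowerBound g (_ , maximal-g) =
    let k , colouring-k , p<k = large-greedyColouring p
    in  subst (_≤ g) (+-comm 1 (suc p)) (≤-trans p<k (maximal-g k colouring-k))
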